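{- Let $n,k$ be positive integers and let $P=\{y_1<\cdots<y_k\}\subseteq[n]$ be a $k$-polygon with shape $s(P)=(d_1,\ldots,d_k)$. Then there is $j_0\in[k]$ such that, with $i'=n-y_{j_0}$, we have $n\in\rho_{i'}(P)$ and $|\rho_{i'}(P)\cap\{1,\ldots,\lceil mn/k\rceil-1\}|<m$ for all $m\in[k]$. Moreover, for every $m\in[k]$: (a) $|\rho_{i'}(P)\cap\{1,\ldots,\lfloor mn/k\rfloor\}|=m$ holds if and only if $\lfloor mn/k\rfloor=mn/k$ and $\sum_{i=j_0}^{j_0+m-1}d_i=mn/k$ (indices modulo $k$); (b) if $|\rho_{i'}(P)\cap\{1,\ldots,\lceil mn/k\rceil\}|=m$ then $\lceil mn/k\rceil\in\rho_{i'}(P)$.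
   Context: A $k$-polygon on $[n]=\{1,\ldots,n\}$ is a $k$-subset of $[n]$, with the elements of $[n]$ viewed in clockwise order on a circle. For $P=\{y_1<\cdots<y_k\}$, its shape is $s(P)=(y_2-y_1,y_3-y_2,\ldots,y_k-y_{k-1},y_1-y_k+n)\in\mathbb{Z}_{\geq1}^k$, so $d_i=y_{i+1}-y_i$ with $y_{k+1}=y_1+n$. For an integer $t\geq0$, $\rho_t(P)$ denotes the clockwise rotation of $P$ by $t$, i.e. the $k$-polygon $\{y_1+t,\ldots,y_k+t\}$ with addition taken modulo $n$ and representatives in $[n]$. -}

module Defs where

open import Data.Nat using (ℕ; zero; suc; _+_; _*_; _∸_; _≤_; _<_; NonZero; _≡ᵇ_)
open import Data.Nat.DivMod using (_/_; _%_; _mod_)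
open import Data.Fin using (Fin; toℕ)
import Data.Fin as F
open import Data.Bool using (if_then_else_)
open import Data.List using (List; length; filter; map; upTo)
open import Data.Nat.ListAction using (sum)
open import Data.Fin.Properties using (any?)
open import Data.Product using (Σ; ∃; _×_)
open import Relation.Binary.PropositionalEquality using (_≡_)
open import Data.Nat using (_≟_)

-- A k-polygon on [n] = {1,...,n}, given by its elements listed increasingly:
-- P = {y 0 < y 1 < ... < y (k-1)} ⊆ [n]  (the paper's y_1 < ... < y_k).
IsPolygon : (n k : ℕ) → (Fin k → ℕ) → Set
IsPolygon n k y =
  (∀ i → 1 ≤ y i × y i ≤ n) × (∀ (i j : Fin k) → i F.< j → y i < y j)

-- Shape s(P) = (d_1,...,d_k), d_i = y_{i+1} - y_i, with y_{k+1} = y_1 + n.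
-- (0-based: d i = y ((i+1) mod k) + [i+1 = k]·n - y i.)
shape : (n k : ℕ) .{{_ : NonZero k}} → (Fin k → ℕ) → Fin k → ℕ
shape n k y i =
  (y ((suc (toℕ i)) mod k) + (if suc (toℕ i) ≡ᵇ k then n else 0)) ∸ y i

rotElt : (n : ℕ) .{{_ : NonZero n}} → ℕ → ℕ → ℕ
rotElt n t x = suc ((x + t ∸ 1) % n)

_∈ρ[_,_,_] : ℕ → (n : ℕ) .{{_ : NonZero n}} → ℕ → {k : ℕ} → (Fin k → ℕ) → Set
x ∈ρ[ n , t , y ] = ∃ λ i → rotElt n t (y i) ≡ x

cardρ≤ : (n : ℕ) .{{_ : NonZero n}} → ℕ → {k : ℕ} → (Fin k → ℕ) → ℕ → ℕ
cardρ≤ n t {k} y L =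
  length (filter (λ x → any? (λ i → rotElt n t (y i) ≟ x)) (map suc (upTo L)))

⌈_/_⌉ : ℕ → (k : ℕ) .{{_ : NonZero k}} → ℕ
⌈ a / k ⌉ = (a + (k ∸ 1)) / k

sumUpTo : ℕ → (ℕ → ℕ) → ℕ
sumUpTo m f = sum (map f (upTo m))

-- Lift the vertices periodically, Y (j + k) = Y j + n, and let j₀ minimise k·y_j − j·n, so
-- that every lifted vertex lies on or above the line of slope n/k through Y j₀:
-- k·(Y (j₀ + m) − Y j₀) ≥ m·n.  Rotation by n − y j₀ maps P onto {w 0 < ⋯ < w (k−1) = n} with
-- w t = Y (j₀ + t + 1) − Y j₀, which is also the sum of the shape entries d_{j₀}, …, d_{j₀+t}.
-- Hence w (m−1) ≥ ⌈mn/k⌉, while exactly m rotated points lie in [1, L] iff w (m−1) ≤ L < w m;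
-- each claim follows by comparing L with w (m−1).
module Submission where

open import Defs
open import Data.Bool using (true; false; if_then_else_; T)
open import Data.Empty using (⊥-elim)
open import Data.Fin using (Fin; toℕ)
open import Data.Fin.Properties using (toℕ-fromℕ<; toℕ-injective; toℕ<n; any?)
open import Data.List using ([]; [_]; _++_; length; filter; map; upTo; allFin)
open import Data.List.Extrema.Nat using (argmin; f[argmin]≤f[xs])
open import Data.List.Membership.Propositional.Properties using (∈-allFin)
open import Data.List.Properties
  using (upTo-∷ʳ; map-++; filter-++; length-++; filter-accept; filter-reject)
import Data.List.Relation.Unary.All as All
open import Data.Nat
open import Data.Nat.DivMod
open import Data.Nat.Divisibility using (_∣_; divides; ∣-refl; n∣m*n)
open import Data.Nat.ListAction using (sum)
open import Data.Nat.ListAction.Properties using (sum-++)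
open import Data.Nat.Properties
open import Data.Nat.Tactic.RingSolver using (solve-∀)
open import Data.Product using (∃; ∃-syntax; _×_; _,_; proj₁; proj₂)
open import Data.Sum using (inj₁; inj₂)
open import Data.Unit using (tt)
open import Function using (_∘_)
open import Function.Bundles using (_⇔_; mk⇔)
open import Relation.Binary.Definitions using (tri<; tri≈; tri>)
open import Relation.Binary.PropositionalEquality hiding ([_]; J)
open import Relation.Nullary using (Dec; yes; no; ¬_)

sumUpTo-suc : ∀ m f → sumUpTo (suc m) f ≡ sumUpTo m f + f m
sumUpTo-suc m f = begin
  sum (map f (upTo (suc m)))        ≡⟨ cong (sum ∘ map f) (upTo-∷ʳ m) ⟨
  sum (map f (upTo m ++ [ m ]))     ≡⟨ cong sum (map-++ f (upTo m) [ m ]) ⟩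
  sum (map f (upTo m) ++ [ f m ])   ≡⟨ sum-++ (map f (upTo m)) [ f m ] ⟩
  sumUpTo m f + (f m + 0)           ≡⟨ cong (sumUpTo m f +_) (+-identityʳ (f m)) ⟩
  sumUpTo m f + f m                 ∎
  where open ≡-Reasoning

a≤k*w⇒⌈a/k⌉≤w : ∀ a k w .{{_ : NonZero k}} → a ≤ k * w → ⌈ a / k ⌉ ≤ w
a≤k*w⇒⌈a/k⌉≤w a k@(suc k-1) w a≤kw = <⇒≤pred (m<n*o⇒m/o<n (begin-strict
  a + k-1    ≤⟨ +-monoˡ-≤ k-1 a≤kw ⟩
  k * w + k-1 <⟨ +-monoʳ-< (k * w) (n<1+n k-1) ⟩
  k * w + k   ≡⟨ trans (+-comm (k * w) k) (cong (k +_) (*-comm k w)) ⟩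
  suc w * k   ∎))
  where open ≤-Reasoning

w≤a/k∧a≤k*w⇒a≡w*k : ∀ {a k w} .{{_ : NonZero k}} → w ≤ a / k → a ≤ k * w → a ≡ w * k
w≤a/k∧a≤k*w⇒a≡w*k {a} {k} {w} w≤a/k a≤kw = ≤-antisym
  (subst (a ≤_) (*-comm k w) a≤kw)
  (≤-trans (*-monoˡ-≤ k w≤a/k) (m/n*n≤m a k))

suc≡ᵇfalse⇒suc< : ∀ {r k} → r < k → (suc r ≡ᵇ k) ≡ false → suc r < k
suc≡ᵇfalse⇒suc< r<k wraps = ≤∧≢⇒< r<k (λ e → subst T wraps (≡⇒≡ᵇ _ _ e))

suc≡ᵇtrue⇒suc≡ : ∀ {r k} → (suc r ≡ᵇ k) ≡ true → suc r ≡ k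
suc≡ᵇtrue⇒suc≡ wraps = ≡ᵇ⇒≡ _ _ (subst T (sym wraps) tt)

x+qn≡a+r⇒rotElt[n∸a]x≡r : ∀ {n a x q r} .{{_ : NonZero n}} → a ≤ n → 1 ≤ x → 1 ≤ r → r ≤ n →
  x + q * n ≡ a + r → rotElt n (n ∸ a) x ≡ r
x+qn≡a+r⇒rotElt[n∸a]x≡r {n} {a} {suc x} {q} {suc r} a≤n _ _ r<n eq = cong suc (begin
  (x + (n ∸ a)) % n           ≡⟨ [m+kn]%n≡m%n (x + (n ∸ a)) q n ⟨
  (x + (n ∸ a) + q * n) % n   ≡⟨ cong (_% n) unwind ⟩
  (r + n) % n                 ≡⟨ [m+n]%n≡m%n r n ⟩
  r % n                       ≡⟨ m<n⇒m%n≡m r<n ⟩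
  r                           ∎)
  where
  open ≡-Reasoning
  unwind : x + (n ∸ a) + q * n ≡ r + n
  unwind = +-cancelʳ-≡ a _ _ (begin
    x + (n ∸ a) + q * n + a   ≡⟨ swap x (n ∸ a) (q * n) a ⟩
    x + q * n + (n ∸ a + a)   ≡⟨ cong₂ _+_ (suc-injective (trans eq (+-suc a r))) (m∸n+n≡m a≤n) ⟩
    a + r + n                 ≡⟨ rotate a r n ⟩
    r + n + a                 ∎)
    where
    swap : ∀ x d e a → x + d + e + a ≡ x + e + (d + a)
    swap = solve-∀
    rotate : ∀ a r n → a + r + n ≡ r + n + a
    rotate = solve-∀

+[k∸u]*n≤+[k∸v]*n⇒+v*n≤+u*n : ∀ {a b k u v} n → u ≤ k → v ≤ k →
  a + (k ∸ u) * n ≤ b + (k ∸ v) * n → a + v * n ≤ b + u * n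
+[k∸u]*n≤+[k∸v]*n⇒+v*n≤+u*n {a} {b} {k} {u} {v} n u≤k v≤k le =
  +-cancelʳ-≤ (k * n) _ _ (begin
    a + v * n + k * n                       ≡⟨ cong (λ c → a + v * n + c * n) (m∸n+n≡m u≤k) ⟨
    a + v * n + (k ∸ u + u) * n             ≡⟨ regroup n a v (k ∸ u) u ⟩
    a + (k ∸ u) * n + (v * n + u * n)       ≡⟨ cong (a + (k ∸ u) * n +_) (+-comm (v * n) (u * n)) ⟩
    a + (k ∸ u) * n + (u * n + v * n)       ≤⟨ +-monoˡ-≤ (u * n + v * n) le ⟩
    b + (k ∸ v) * n + (u * n + v * n)       ≡⟨ regroup n b u (k ∸ v) v ⟨
    b + u * n + (k ∸ v + v) * n             ≡⟨ cong (λ c → b + u * n + c * n) (m∸n+n≡m v≤k) ⟩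
    b + u * n + k * n                       ∎)
  where
  open ≤-Reasoning
  regroup : ∀ n a c d e → a + c * n + (d + e) * n ≡ a + d * n + (c * n + e * n)
  regroup = solve-∀

offset : ∀ {J j k} → J < j → j ≤ J + k → ∃[ t ] t < k × J + suc t ≡ j
offset {J} {j} {k} J<j j≤J+k =
  j ∸ suc J , +-cancelˡ-≤ J _ _ (subst (_≤ J + k) (sym J+t≡j) j≤J+k) , J+t≡j
  where
  J+t≡j : J + suc (j ∸ suc J) ≡ j
  J+t≡j = trans (+-suc J (j ∸ suc J)) (m+[n∸m]≡n J<j)

module Counting {P : ℕ → Set} (P? : ∀ x → Dec (P x)) (k : ℕ) (w : ℕ → ℕ)
  (w-mono : ∀ {a b} → a < b → w a < w b) (w-pos : ∀ t → 0 < w t)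
  (P⇒w : ∀ {x} → P x → ∃[ t ] t < k × w t ≡ x) (w⇒P : ∀ {t} → t < k → P (w t)) where

  count : ℕ → ℕ
  count L = length (filter P? (map suc (upTo L)))

  w-mono≤ : ∀ {a b} → a ≤ b → w a ≤ w b
  w-mono≤ a≤b with m≤n⇒m<n∨m≡n a≤b
  ... | inj₁ a<b = <⇒≤ (w-mono a<b)
  ... | inj₂ refl = ≤-refl

  count-suc : ∀ L → count (suc L) ≡ count L + length (filter P? [ suc L ])
  count-suc L = begin
    length (filter P? (map suc (upTo (suc L))))
      ≡⟨ cong (length ∘ filter P? ∘ map suc) (upTo-∷ʳ L) ⟨
    length (filter P? (map suc (upTo L ++ [ L ])))
      ≡⟨ cong (length ∘ filter P?) (map-++ suc (upTo L) [ L ]) ⟩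
    length (filter P? (map suc (upTo L) ++ [ suc L ]))
      ≡⟨ cong length (filter-++ P? (map suc (upTo L)) [ suc L ]) ⟩
    length (filter P? (map suc (upTo L)) ++ filter P? [ suc L ])
      ≡⟨ length-++ (filter P? (map suc (upTo L))) ⟩
    count L + length (filter P? [ suc L ]) ∎
    where open ≡-Reasoning

  count-suc-∈ : ∀ {L} → P (suc L) → count (suc L) ≡ suc (count L)
  count-suc-∈ {L} p = trans (count-suc L)
    (trans (cong (λ xs → count L + length xs) (filter-accept P? {xs = []} p)) (+-comm (count L) 1))

  count-suc-∉ : ∀ {L} → ¬ P (suc L) → count (suc L) ≡ count L
  count-suc-∉ {L} ¬p = trans (count-suc L)
    (trans (cong (λ xs → count L + length xs) (filter-reject P? {xs = []} ¬p))
           (+-identityʳ (count L)))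

  Rank : ℕ → ℕ → Set
  Rank L m = m ≤ k × (∀ {s} → s < m → w s ≤ L) × (∀ {s} → m ≤ s → s < k → L < w s)

  hit-index : ∀ {L m s} → Rank L m → s < k → w s ≡ suc L → s ≡ m
  hit-index {L} {m} {s} (_ , below , above) s<k ws≡ with <-cmp s m
  ... | tri< s<m _ _ = ⊥-elim (1+n≰n (subst (_≤ L) ws≡ (below s<m)))
  ... | tri≈ _ s≡m _ = s≡m
  ... | tri> _ _ m<s = ⊥-elim (<⇒≱ (above ≤-refl (<-trans m<s s<k))
                                     (≤-pred (subst (w m <_) ws≡ (w-mono m<s))))

  rank-hit : ∀ {L m} → Rank L m → P (suc L) → Rank (suc L) (suc m)
  rank-hit r p with P⇒w p
  ... | s , s<k , ws≡ with refl ← hit-index r s<k ws≡ =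
    s<k , (λ {s′} s′≤s → subst (w s′ ≤_) ws≡ (w-mono≤ (≤-pred s′≤s)))
        , λ {s′} s<s′ _ → subst (_< w s′) ws≡ (w-mono s<s′)

  rank-miss : ∀ {L m} → Rank L m → ¬ P (suc L) → Rank (suc L) m
  rank-miss (m≤k , below , above) ¬p =
    m≤k , (m≤n⇒m≤1+n ∘ below)
        , λ m≤s s<k → ≤∧≢⇒< (above m≤s s<k) (λ e → ¬p (subst P (sym e) (w⇒P s<k)))

  rank-count : ∀ L → Rank L (count L)
  rank-count zero = z≤n , (λ ()) , λ _ _ → w-pos _
  rank-count (suc L) with P? (suc L)
  ... | yes p = subst (Rank (suc L)) (sym (count-suc-∈ p)) (rank-hit (rank-count L) p)
  ... | no ¬p = subst (Rank (suc L)) (sym (count-suc-∉ ¬p)) (rank-miss (rank-count L) ¬p)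

  count≤ : ∀ {L t} → L < w t → count L ≤ t
  count≤ {L} L<wt with _ , below , _ ← rank-count L = ≮⇒≥ (λ t<c → <⇒≱ L<wt (below t<c))

  count≡suc⇒w≤ : ∀ {L t} → count L ≡ suc t → w t ≤ L
  count≡suc⇒w≤ {L} c≡ with _ , below , _ ← rank-count L = below (≤-reflexive (sym c≡))

  count≡suc : ∀ {L t} → t < k → w t ≤ L → L < w (suc t) → count L ≡ suc t
  count≡suc {L} t<k wt≤L L<w with _ , _ , above ← rank-count L =
    ≤-antisym (count≤ L<w) (≮⇒≥ λ c<1+t → <⇒≱ (above (≤-pred c<1+t) t<k) wt≤L)

module Polygon (n k : ℕ) .{{_ : NonZero n}} .{{_ : NonZero k}} (y : Fin k → ℕ)
  (poly : IsPolygon n k y) where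

  y-pos : ∀ i → 1 ≤ y i
  y-pos i = proj₁ (proj₁ poly i)

  y≤n : ∀ i → y i ≤ n
  y≤n i = proj₂ (proj₁ poly i)

  mod-cong : ∀ {j j′} → j % k ≡ j′ % k → j mod k ≡ j′ mod k
  mod-cong e = toℕ-injective (trans (toℕ-fromℕ< _) (trans e (sym (toℕ-fromℕ< _))))

  toℕ-mod : ∀ i → toℕ i mod k ≡ i
  toℕ-mod i = toℕ-injective (trans (toℕ-fromℕ< _) (m<n⇒m%n≡m (toℕ<n i)))

  next-vertex : ∀ i → y i < y (suc (toℕ i) mod k) + (if suc (toℕ i) ≡ᵇ k then n else 0)
  next-vertex i with suc (toℕ i) ≡ᵇ k in wraps
  ... | true  = ≤-<-trans (y≤n i) (m<n+m n (y-pos _))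
  ... | false = <-≤-trans (proj₂ poly i _ i<next) (m≤m+n _ 0)
    where
    i<next : toℕ i < toℕ (suc (toℕ i) mod k)
    i<next = subst (toℕ i <_)
      (sym (trans (toℕ-fromℕ< _) (m<n⇒m%n≡m (suc≡ᵇfalse⇒suc< (toℕ<n i) wraps)))) (n<1+n (toℕ i))

  shape-spec : ∀ i →
    y i + shape n k y i ≡ y (suc (toℕ i) mod k) + (if suc (toℕ i) ≡ᵇ k then n else 0)
  shape-spec i = m+[n∸m]≡n (<⇒≤ (next-vertex i))

  shape-pos : ∀ i → 0 < shape n k y i
  shape-pos i = m<n⇒0<n∸m (next-vertex i)

  carry : ∀ {r} → r < k → suc r / k * n ≡ (if suc r ≡ᵇ k then n else 0)
  carry {r} r<k with suc r ≡ᵇ k in wraps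
  ... | true  = trans (cong (λ d → d / k * n) (suc≡ᵇtrue⇒suc≡ wraps))
                      (trans (cong (_* n) (n/n≡1 k)) (*-identityˡ n))
  ... | false = cong (_* n) (m<n⇒m/n≡0 (suc≡ᵇfalse⇒suc< r<k wraps))

  Y : ℕ → ℕ
  Y j = y (j mod k) + j / k * n

  Y-toℕ : ∀ i → Y (toℕ i) ≡ y i
  Y-toℕ i = trans (cong₂ _+_ (cong y (toℕ-mod i)) (cong (_* n) (m<n⇒m/n≡0 (toℕ<n i))))
                  (+-identityʳ (y i))

  Y-+k : ∀ j → Y (j + k) ≡ Y j + n
  Y-+k j = begin
    y ((j + k) mod k) + (j + k) / k * n
      ≡⟨ cong₂ _+_ (cong y (mod-cong ([m+n]%n≡m%n j k))) (cong (_* n) quotient) ⟩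
    y (j mod k) + suc (j / k) * n         ≡⟨ step (y (j mod k)) (j / k) n ⟩
    y (j mod k) + j / k * n + n           ∎
    where
    open ≡-Reasoning
    quotient : (j + k) / k ≡ suc (j / k)
    quotient = trans (+-distrib-/-∣ʳ j ∣-refl) (trans (cong (j / k +_) (n/n≡1 k)) (+-comm (j / k) 1))
    step : ∀ a q n → a + suc q * n ≡ a + q * n + n
    step = solve-∀

  Y-suc : ∀ j → Y (suc j) ≡ Y j + shape n k y (j mod k)
  Y-suc j = begin
    y (suc j mod k) + suc j / k * n
      ≡⟨ cong₂ _+_ (cong y (mod-cong remainder)) (cong (_* n) quotient) ⟩
    y (suc r mod k) + (suc r / k + q) * n
      ≡⟨ cong (y (suc r mod k) +_) (*-distribʳ-+ n (suc r / k) q) ⟩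
    y (suc r mod k) + (suc r / k * n + q * n)
      ≡⟨ cong (λ c → y (suc r mod k) + (c + q * n)) (carry (toℕ<n i)) ⟩
    y (suc r mod k) + (c + q * n)
      ≡⟨ +-assoc (y (suc r mod k)) c (q * n) ⟨
    y (suc r mod k) + c + q * n
      ≡⟨ cong (_+ q * n) (shape-spec i) ⟨
    y i + shape n k y i + q * n
      ≡⟨ swap (y i) (shape n k y i) (q * n) ⟩
    y i + q * n + shape n k y i
      ∎
    where
    open ≡-Reasoning
    i = j mod k
    r = toℕ i
    q = j / k
    c = if suc r ≡ᵇ k then n else 0
    euclid : suc j ≡ suc r + q * k
    euclid = cong suc (trans (m≡m%n+[m/n]*n j k) (cong (_+ q * k) (sym (toℕ-fromℕ< _))))
    remainder : suc j % k ≡ suc r % k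
    remainder = trans (cong (_% k) euclid) ([m+kn]%n≡m%n (suc r) q k)
    quotient : suc j / k ≡ suc r / k + q
    quotient = trans (/-congˡ euclid)
      (trans (+-distrib-/-∣ʳ (suc r) (n∣m*n q)) (cong (suc r / k +_) (m*n/n≡m q k)))
    swap : ∀ a b c → a + b + c ≡ a + c + b
    swap = solve-∀

  Y-<-suc : ∀ j → Y j < Y (suc j)
  Y-<-suc j = subst (Y j <_) (sym (Y-suc j)) (m<m+n (Y j) (shape-pos (j mod k)))

  Y-mono : ∀ {a b} → a < b → Y a < Y b
  Y-mono {a} {suc b} a<1+b with m≤n⇒m<n∨m≡n (≤-pred a<1+b)
  ... | inj₁ a<b  = <-trans (Y-mono a<b) (Y-<-suc b)
  ... | inj₂ refl = Y-<-suc a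

  Y-mono≤ : ∀ {a b} → a ≤ b → Y a ≤ Y b
  Y-mono≤ a≤b with m≤n⇒m<n∨m≡n a≤b
  ... | inj₁ a<b  = <⇒≤ (Y-mono a<b)
  ... | inj₂ refl = ≤-refl

  Y+sumUpTo-shape : ∀ j m → Y j + sumUpTo m (λ t → shape n k y ((j + t) mod k)) ≡ Y (j + m)
  Y+sumUpTo-shape j zero = trans (+-identityʳ (Y j)) (cong Y (sym (+-identityʳ j)))
  Y+sumUpTo-shape j (suc m) = begin
    Y j + sumUpTo (suc m) s                   ≡⟨ cong (Y j +_) (sumUpTo-suc m s) ⟩
    Y j + (sumUpTo m s + s m)                 ≡⟨ +-assoc (Y j) (sumUpTo m s) (s m) ⟨
    Y j + sumUpTo m s + s m                   ≡⟨ cong (_+ s m) (Y+sumUpTo-shape j m) ⟩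
    Y (j + m) + shape n k y ((j + m) mod k)   ≡⟨ Y-suc (j + m) ⟨
    Y (suc (j + m))                           ≡⟨ cong Y (+-suc j m) ⟨
    Y (j + suc m)                             ∎
    where
    open ≡-Reasoning
    s = λ t → shape n k y ((j + t) mod k)

  -- k·y_i − i·n, shifted by k·n to stay in ℕ
  height : Fin k → ℕ
  height i = k * y i + (k ∸ toℕ i) * n

  j₀ : Fin k
  j₀ = argmin height (0 mod k) (allFin k)

  J : ℕ
  J = toℕ j₀

  height-minimal : ∀ i → height j₀ ≤ height i
  height-minimal i = All.lookup (f[argmin]≤f[xs] (0 mod k) (allFin k)) (∈-allFin i)

  above-line : ∀ j → k * Y J + j * n ≤ k * Y j + J * n
  above-line j = begin
    k * Y J + j * n                         ≡⟨ cong₂ (λ a b → k * a + b * n) (Y-toℕ j₀) euclid ⟩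
    k * y j₀ + (toℕ i + q * k) * n          ≡⟨ expand k (y j₀) (toℕ i) q n ⟩
    k * y j₀ + toℕ i * n + q * k * n        ≤⟨ +-monoˡ-≤ (q * k * n) vertex ⟩
    k * y i + J * n + q * k * n             ≡⟨ collect k (y i) J q n ⟩
    k * (y i + q * n) + J * n               ∎
    where
    open ≤-Reasoning
    i = j mod k
    q = j / k
    euclid : j ≡ toℕ i + q * k
    euclid = trans (m≡m%n+[m/n]*n j k) (cong (_+ q * k) (sym (toℕ-fromℕ< _)))
    vertex : k * y j₀ + toℕ i * n ≤ k * y i + J * n
    vertex = +[k∸u]*n≤+[k∸v]*n⇒+v*n≤+u*n n (<⇒≤ (toℕ<n j₀)) (<⇒≤ (toℕ<n i)) (height-minimal i)
    expand : ∀ k a r q n → k * a + (r + q * k) * n ≡ k * a + r * n + q * k * n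
    expand = solve-∀
    collect : ∀ k b J q n → k * b + J * n + q * k * n ≡ k * (b + q * n) + J * n
    collect = solve-∀

  w : ℕ → ℕ
  w t = Y (J + suc t) ∸ Y J

  w-mono : ∀ {a b} → a < b → w a < w b
  w-mono a<b = ∸-monoˡ-< (Y-mono (+-monoʳ-< J (s≤s a<b))) (Y-mono≤ (m≤m+n J _))

  w-pos : ∀ t → 0 < w t
  w-pos t = m<n⇒0<n∸m (Y-mono (m<m+n J z<s))

  sumUpTo-shape≡w : ∀ t → sumUpTo (suc t) (λ s → shape n k y ((J + s) mod k)) ≡ w t
  sumUpTo-shape≡w t = trans (sym (m+n∸m≡n (Y J) _)) (cong (_∸ Y J) (Y+sumUpTo-shape J (suc t)))

  slope-bound : ∀ t → suc t * n ≤ k * w t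
  slope-bound t = +-cancelˡ-≤ (k * Y J + J * n) _ _ (begin
    k * Y J + J * n + suc t * n     ≡⟨ split (k * Y J) J (suc t) n ⟩
    k * Y J + (J + suc t) * n       ≤⟨ above-line (J + suc t) ⟩
    k * Y (J + suc t) + J * n       ≡⟨ cong (λ b → k * b + J * n) (m+[n∸m]≡n (Y-mono≤ (m≤m+n J (suc t)))) ⟨
    k * (Y J + w t) + J * n         ≡⟨ distribute k (Y J) (w t) (J * n) ⟩
    k * Y J + J * n + k * w t       ∎)
    where
    open ≤-Reasoning
    split : ∀ a J s n → a + J * n + s * n ≡ a + (J + s) * n
    split = solve-∀
    distribute : ∀ k b c d → k * (b + c) + d ≡ k * b + d + k * c
    distribute = solve-∀

  ceiling-bound : ∀ t → ⌈ suc t * n / k ⌉ ≤ w t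
  ceiling-bound t = a≤k*w⇒⌈a/k⌉≤w _ k _ (slope-bound t)

  rotElt-Y : ∀ {j} → J < j → j ≤ J + k → rotElt n (n ∸ y j₀) (y (j mod k)) ≡ Y j ∸ Y J
  rotElt-Y {j} J<j j≤J+k =
    x+qn≡a+r⇒rotElt[n∸a]x≡r {q = j / k} (y≤n j₀) (y-pos _) (m<n⇒0<n∸m (Y-mono J<j)) ≤n lift
    where
    lift : Y j ≡ y j₀ + (Y j ∸ Y J)
    lift = trans (sym (m+[n∸m]≡n (Y-mono≤ (<⇒≤ J<j)))) (cong (_+ (Y j ∸ Y J)) (Y-toℕ j₀))
    ≤n : Y j ∸ Y J ≤ n
    ≤n = subst (Y j ∸ Y J ≤_) (trans (cong (_∸ Y J) (Y-+k J)) (m+n∸m≡n (Y J) n))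
               (∸-monoˡ-≤ (Y J) (Y-mono≤ j≤J+k))

  lift-index : ∀ i → ∃[ j ] J < j × j ≤ J + k × j mod k ≡ i
  lift-index i with J <? toℕ i
  ... | yes J<i = toℕ i , J<i , ≤-trans (<⇒≤ (toℕ<n i)) (m≤n+m k J) , toℕ-mod i
  ... | no J≮i  = toℕ i + k , <-≤-trans (toℕ<n j₀) (m≤n+m k (toℕ i)) , +-monoˡ-≤ k (≮⇒≥ J≮i)
                , trans (mod-cong ([m+n]%n≡m%n (toℕ i) k)) (toℕ-mod i)

  w∈ρ : ∀ {t} → t < k → w t ∈ρ[ n , n ∸ y j₀ , y ]
  w∈ρ t<k = (J + suc _) mod k , rotElt-Y (m<m+n J z<s) (+-monoʳ-≤ J t<k)

  ∈ρ⇒w : ∀ {x} → x ∈ρ[ n , n ∸ y j₀ , y ] → ∃[ t ] t < k × w t ≡ x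
  ∈ρ⇒w (i , rot≡x) with lift-index i
  ... | j , J<j , j≤J+k , j≡i with offset J<j j≤J+k
  ...   | t , t<k , J+t≡j = t , t<k , (begin
    Y (J + suc t) ∸ Y J                  ≡⟨ cong (λ j → Y j ∸ Y J) J+t≡j ⟩
    Y j ∸ Y J                            ≡⟨ rotElt-Y J<j j≤J+k ⟨
    rotElt n (n ∸ y j₀) (y (j mod k))    ≡⟨ cong (rotElt n (n ∸ y j₀) ∘ y) j≡i ⟩
    rotElt n (n ∸ y j₀) (y i)            ≡⟨ rot≡x ⟩
    _                                    ∎)
    where open ≡-Reasoning

  open Counting (λ x → any? (λ i → rotElt n (n ∸ y j₀) (y i) ≟ x)) k w w-mono w-pos ∈ρ⇒w w∈ρ

  n∈ρ : n ∈ρ[ n , n ∸ y j₀ , y ]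
  n∈ρ = j₀ , x+qn≡a+r⇒rotElt[n∸a]x≡r {q = 1} (y≤n j₀) (y-pos j₀) (≤-trans (y-pos j₀) (y≤n j₀))
                                                ≤-refl (cong (y j₀ +_) (*-identityˡ n))

  count-below-ceiling : ∀ m → 1 ≤ m → m ≤ k → cardρ≤ n (n ∸ y j₀) y (⌈ m * n / k ⌉ ∸ 1) < m
  count-below-ceiling (suc t) _ _ =
    s≤s (count≤ (≤-<-trans (∸-monoˡ-≤ 1 (ceiling-bound t)) (∸-monoʳ-< z<s (w-pos t))))

  count-at-floor : ∀ m → 1 ≤ m → m ≤ k →
    (cardρ≤ n (n ∸ y j₀) y ((m * n) / k) ≡ m)
      ⇔ ((k ∣ m * n) × (sumUpTo m (λ t → shape n k y ((J + t) mod k)) ≡ (m * n) / k))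
  count-at-floor (suc t) _ t<k = mk⇔ to from
    where
    L = suc t * n / k
    s = λ u → shape n k y ((J + u) mod k)
    to : cardρ≤ n (n ∸ y j₀) y L ≡ suc t → (k ∣ suc t * n) × (sumUpTo (suc t) s ≡ L)
    to c≡ = divides (w t) mn≡ , trans (sumUpTo-shape≡w t) (sym (trans (/-congˡ mn≡) (m*n/n≡m (w t) k)))
      where
      mn≡ : suc t * n ≡ w t * k
      mn≡ = w≤a/k∧a≤k*w⇒a≡w*k (count≡suc⇒w≤ c≡) (slope-bound t)
    from : (k ∣ suc t * n) × (sumUpTo (suc t) s ≡ L) → cardρ≤ n (n ∸ y j₀) y L ≡ suc t
    from (_ , sum≡) = count≡suc t<k (≤-reflexive w≡) (subst (_< w (suc t)) w≡ (w-mono (n<1+n t)))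
      where
      w≡ : w t ≡ L
      w≡ = trans (sym (sumUpTo-shape≡w t)) sum≡

  count-at-ceiling⇒∈ρ : ∀ m → 1 ≤ m → m ≤ k →
    cardρ≤ n (n ∸ y j₀) y ⌈ m * n / k ⌉ ≡ m → ⌈ m * n / k ⌉ ∈ρ[ n , n ∸ y j₀ , y ]
  count-at-ceiling⇒∈ρ (suc t) _ t<k c≡ =
    subst (_∈ρ[ n , n ∸ y j₀ , y ]) (≤-antisym (count≡suc⇒w≤ c≡) (ceiling-bound t)) (w∈ρ t<k)

corollary8 : (n k : ℕ) .{{_ : NonZero n}} .{{_ : NonZero k}} →
    (y : Fin k → ℕ) → IsPolygon n k y →
    ∃ λ (j₀ : Fin k) →
      (n ∈ρ[ n , n ∸ y j₀ , y ])
      × (∀ m → 1 ≤ m → m ≤ k → cardρ≤ n (n ∸ y j₀) y (⌈ m * n / k ⌉ ∸ 1) < m)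
      × (∀ m → 1 ≤ m → m ≤ k →
          (cardρ≤ n (n ∸ y j₀) y ((m * n) / k) ≡ m)
            ⇔ ((k ∣ m * n)
               × (sumUpTo m (λ t → shape n k y ((toℕ j₀ + t) mod k)) ≡ (m * n) / k)))
      × (∀ m → 1 ≤ m → m ≤ k →
          cardρ≤ n (n ∸ y j₀) y ⌈ m * n / k ⌉ ≡ m →
          ⌈ m * n / k ⌉ ∈ρ[ n , n ∸ y j₀ , y ])
corollary8 n k y poly = j₀ , n∈ρ , count-below-ceiling , count-at-floor , count-at-ceiling⇒∈ρ
  where open Polygon n k y poly
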